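{- Let $\Sigma$ be the signature consisting of two constant symbols $a,b$, and let $$\phi(a,b):=\big(=(a,b)\wedge =(b,a)\wedge\exists^{\mathrm{i}}z(z\neq b)\;\to\;\exists^{\mathrm{i}}u(u\neq a)\big).$$ If $M=(W,D,I)$ is a full first-order information model for $\Sigma$, then $M\models\phi(a,b)$ if and only if $D$ is finite.
   Context: $\mathsf{InqBQ}$ formulas: $\phi ::= p \mid \bot \mid (\phi\wedge\phi)\mid(\phi\veebar\phi)\mid(\phi\to\phi)\mid\forall x\phi\mid\exists^{\mathrm{i}}x\phi$, with $p$ first-order atoms; $\neg\phi:=\phi\to\bot$, $t\neq t':=\neg(t=t')$. For a term $t$, $\lambda t:=\forall x\,((x=t)\veebar\neg(x=t))$ with $x$ not in $t$, and $=(t,t'):=\lambda t\to\lambda t'$. A first-order information model is $M=(W,D,I)$ with non-empty sets $W$ (worlds) and $D$ (individuals), and for each $w\in W$ an interpretation $I_w$ of the signature over $D$; for constants write $a_w=I_w(a)$, $b_w=I_w(b)$. Terms are evaluated at a world $w$ and assignment $g$ as $[t]^g_w$. Support $M,s\models_g\phi$ for a state $s\subseteq W$: $M,s\models_g R(t_1,\dots,t_n)$ iff $([t_1]^g_w,\dots,[t_n]^g_w)\in I_w(R)$ for all $w\in s$; $M,s\models_g t_1=t_2$ iff $[t_1]^g_w=[t_2]^g_w$ for all $w\in s$; $\bot$ iff $s=\emptyset$; $\wedge$ conjunction; $\phi\veebar\psi$ iff $\phi$ or $\psi$ supported; $\phi\to\psi$ iff every $t\subseteq s$ supporting $\phi$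 supports $\psi$; $\forall x\phi$ iff $M,s\models_{g[x\mapsto d]}\phi$ for all $d\in D$; $\exists^{\mathrm{i}}x\phi$ iff for some $d\in D$. $M\models\phi$ (for a sentence) means $M,W\models_g\phi$ for any $g$. For $s\subseteq W$ let $R_s=\{(a_w,b_w): w\in s\}$; $M$ is full if $R_W=D^2$. -}

module Defs where

open import Level using (Level; 0ℓ) renaming (suc to lsuc)
open import Data.Nat using (ℕ; _≟_)
open import Data.Fin using (Fin)
open import Data.Product using (Σ; ∃; _×_; _,_)
open import Data.Sum using (_⊎_)
open import Data.Empty using (⊥)
open import Relation.Nullary using (¬_; yes; no)
open import Relation.Binary.PropositionalEquality using (_≡_)
open import Function.Bundles using (_↔_)

data Term : Set where
  var : ℕ → Term
  ca  : Term
  cb  : Term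

data Formula : Set where
  _≐_  : Term → Term → Formula
  ⊥'   : Formula
  _∧'_ : Formula → Formula → Formula
  _⩒_  : Formula → Formula → Formula
  _⇒_  : Formula → Formula → Formula
  ∀'   : ℕ → Formula → Formula
  ∃ⁱ   : ℕ → Formula → Formula

infix  7 _≐_
infixr 6 _∧'_
infixr 5 _⩒_
infixr 4 _⇒_

¬' : Formula → Formula
¬' φ = φ ⇒ ⊥'

_≠'_ : Term → Term → Formula
t ≠' t' = ¬' (t ≐ t')

-- λ t := ∀x ((x = t) ⩒ ¬(x = t)), with x not occurring in t.
-- Here t is always a constant, so the variable 0 is used for x.
λ' : Term → Formula
λ' t = ∀' 0 ((var 0 ≐ t) ⩒ ¬' (var 0 ≐ t))

dep : Term → Term → Formula
dep t t' = λ' t ⇒ λ' t'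

φab : Formula
φab = (dep ca cb ∧' dep cb ca ∧' ∃ⁱ 1 (var 1 ≠' cb)) ⇒ ∃ⁱ 2 (var 2 ≠' ca)

record Model : Set₁ where
  field
    W   : Set
    D   : Set
    w₀  : W
    d₀  : D
    aI  : W → D
    bI  : W → D

open Model public

State : Model → Set₁
State M = W M → Set

_⊆_ : {M : Model} → State M → State M → Set
s ⊆ t = ∀ w → s w → t w

Assignment : Model → Set
Assignment M = ℕ → D M

update : (M : Model) → Assignment M → ℕ → D M → Assignment M
update M g x d y with y ≟ x
... | yes _ = d
... | no  _ = g y

⟦_⟧ : (M : Model) → Term → Assignment M → W M → D M
⟦ M ⟧ (var x) g w = g x
⟦ M ⟧ ca g w = aI M w
⟦ M ⟧ cb g w = bI M w

Supports : (M : Model) → State M → Assignment M → Formula → Set₁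
Supports M s g (t ≐ t')  = Level.Lift _ (∀ w → s w → ⟦ M ⟧ t g w ≡ ⟦ M ⟧ t' g w)
Supports M s g ⊥'        = Level.Lift _ (∀ w → ¬ s w)
Supports M s g (φ ∧' ψ)  = Supports M s g φ × Supports M s g ψ
Supports M s g (φ ⩒ ψ)   = Supports M s g φ ⊎ Supports M s g ψ
Supports M s g (φ ⇒ ψ)   = (t : State M) → _⊆_ {M} t s → Supports M t g φ → Supports M t g ψ
Supports M s g (∀' x φ)  = (d : D M) → Supports M s (update M g x d) φ
Supports M s g (∃ⁱ x φ)  = Σ (D M) λ d → Supports M s (update M g x d) φ

Full-state : (M : Model) → State M
Full-state M w = Level.Lift _ Data.Unit.⊤
  where import Data.Unit

_⊨_ : Model → Formula → Set₁
M ⊨ φ = (g : Assignment M) → Supports M (Full-state M) g φ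

IsFull : Model → Set
IsFull M = (d e : D M) → Σ (W M) λ w → (aI M w ≡ d) × (bI M w ≡ e)

IsFinite : Set → Set
IsFinite X = Σ ℕ λ n → X ↔ Fin n

{-# OPTIONS --safe #-}
-- On a substate t, =(a,b) and =(b,a) say that R_t = {(a_w, b_w) | w ∈ t} is the graph of an
-- injective partial function on D, ∃ⁱz (z ≠ b) that its range misses a point, and ∃ⁱu (u ≠ a)
-- that its domain does. If D is finite, an injection defined on all of D is onto, so φ(a,b)
-- holds. If D is infinite, excluded middle yields an injection ℕ ↣ D, and shifting along it an
-- injective, non-surjective f : D → D; by fullness the graph of f is R_t for
-- t = {w | b_w = f(a_w)}, a substate refuting φ(a,b).
module Submission where

open import Defs
open import Level using (0ℓ; lift; lower) renaming (suc to lsuc)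
open import Axiom.ExcludedMiddle using (ExcludedMiddle)
open import Function.Base using (_∘_)
open import Function.Bundles using (_⇔_; mk⇔; Equivalence; _↣_; mk↣; Injection; mk↔ₛ′)
open import Function.Definitions using (Injective)
open import Function.Properties.Inverse using (↔⇒↣; ↔-sym)
open import Data.Nat using (ℕ; zero; suc; _<_; _≟_)
open import Data.Nat.Properties using (<-cmp; n<1+n; m<1+n⇒m<n∨m≡n; suc-injective; 0≢1+n)
open import Data.Fin using (Fin; zero; suc)
open import Data.Fin.Properties using (<⇒notInjective)
open import Data.Vec.Functional using (_∷_)
open import Data.Product using (Σ; ∃; _×_; _,_; proj₁; proj₂)
open import Data.Sum using (_⊎_; inj₁; inj₂)
open import Data.Unit using (tt)
open import Relation.Nullary using (¬_; Dec; yes; no; contradiction)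
open import Relation.Nullary.Decidable using (decidable-stable)
open import Relation.Binary.Definitions using (tri<; tri≈; tri>)
open import Relation.Binary.PropositionalEquality
  using (_≡_; _≢_; refl; sym; trans; cong)

private variable
  n : ℕ
  Ω X Y : Set

DedekindInfinite : Set → Set
DedekindInfinite X = Σ (X ↣ X) λ f → Σ X λ e → ∀ x → Injection.to f x ≢ e

∷-preservesInjective : {x : X} {h : Fin n → X} →
  Injective _≡_ _≡_ h → (∀ i → h i ≢ x) → Injective _≡_ _≡_ (x ∷ h)
∷-preservesInjective h-inj x∉h {zero}  {zero}  _  = refl
∷-preservesInjective h-inj x∉h {zero}  {suc j} eq = contradiction (sym eq) (x∉h j)
∷-preservesInjective h-inj x∉h {suc i} {zero}  eq = contradiction eq (x∉h i)
∷-preservesInjective h-inj x∉h {suc i} {suc j} eq = cong suc (h-inj eq)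

finite⇒¬dedekindInfinite : IsFinite X → ¬ DedekindInfinite X
finite⇒¬dedekindInfinite (n , X↔Fin) (f , e , e∉f) =
  <⇒notInjective (n<1+n n)
    (∷-preservesInjective (from-injective ∘ f-injective ∘ to-injective)
                          (λ i → e∉f (from i) ∘ to-injective))
  where
  open Injection (↔⇒↣ X↔Fin) using (to) renaming (injective to to-injective)
  open Injection (↔⇒↣ (↔-sym X↔Fin)) using () renaming (to to from; injective to from-injective)
  open Injection f using () renaming (injective to f-injective)

module _ (lem : ExcludedMiddle 0ℓ) (X-infinite : ¬ IsFinite X) where

  fresh : (h : Fin n ↣ X) → ∃ λ x → ∀ i → Injection.to h i ≢ x
  fresh {n} h with lem {∃ λ x → ∀ i → Injection.to h i ≢ x}
  ... | yes x-fresh = x-fresh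
  ... | no  ¬fresh  = contradiction (n , mk↔ₛ′ index to index-to to-index) X-infinite
    where
    open Injection h
    preimage : ∀ x → ∃ λ i → to i ≡ x
    preimage x = decidable-stable lem λ ¬preimage → ¬fresh (x , λ i eq → ¬preimage (i , eq))
    index : X → Fin n
    index x = proj₁ (preimage x)
    index-to : ∀ i → index (to i) ≡ i
    index-to i = injective (proj₂ (preimage (to i)))
    to-index : ∀ x → to (index x) ≡ x
    to-index x = proj₂ (preimage x)

  Fin↣ : ∀ n → Fin n ↣ X
  Fin↣ zero    = mk↣ {to = λ ()} λ {}
  Fin↣ (suc n) = mk↣ (∷-preservesInjective (Injection.injective (Fin↣ n)) (proj₂ (fresh (Fin↣ n))))

  next : ℕ → X
  next n = proj₁ (fresh (Fin↣ n))

  next-∈-Fin↣ : ∀ {m n} → m < n → ∃ λ i → Injection.to (Fin↣ n) i ≡ next m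
  next-∈-Fin↣ {n = suc n} m<1+n with m<1+n⇒m<n∨m≡n m<1+n
  ... | inj₂ refl = zero , refl
  ... | inj₁ m<n  = let i , eq = next-∈-Fin↣ m<n in suc i , eq

  next-distinct : ∀ {m n} → m < n → next m ≢ next n
  next-distinct {n = n} m<n eq =
    let i , to-i≡next-m = next-∈-Fin↣ m<n in proj₂ (fresh (Fin↣ n)) i (trans to-i≡next-m eq)

  ℕ↣ : ℕ ↣ X
  ℕ↣ = mk↣ next-injective
    where
    next-injective : Injective _≡_ _≡_ next
    next-injective {m} {n} eq with <-cmp m n
    ... | tri< m<n _ _ = contradiction eq (next-distinct m<n)
    ... | tri≈ _ m≡n _ = m≡n
    ... | tri> _ _ n<m = contradiction (sym eq) (next-distinct n<m)

ℕ↣⇒dedekindInfinite : ExcludedMiddle 0ℓ → ℕ ↣ X → DedekindInfinite X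
ℕ↣⇒dedekindInfinite {X} lem ℕ↣X = mk↣ (shift′-injective lem lem) , e 0 , λ x → shift′-≢-e0 x lem
  where
  open Injection ℕ↣X using () renaming (to to e; injective to e-injective)

  shift′ : (x : X) → Dec (∃ λ n → e n ≡ x) → X
  shift′ x (yes (n , _)) = e (suc n)
  shift′ x (no _)        = x

  shift′-injective : ∀ {x y} p q → shift′ x p ≡ shift′ y q → x ≡ y
  shift′-injective (yes (m , em≡x)) (yes (n , en≡y)) eq =
    trans (sym em≡x) (trans (cong e (suc-injective (e-injective eq))) en≡y)
  shift′-injective (yes (m , _)) (no ∄n) eq = contradiction (suc m , eq) ∄n
  shift′-injective (no ∄m) (yes (n , _)) eq = contradiction (suc n , sym eq) ∄m
  shift′-injective (no _) (no _) eq = eq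

  shift′-≢-e0 : ∀ x p → shift′ x p ≢ e 0
  shift′-≢-e0 x (yes (n , _)) eq = 0≢1+n (sym (e-injective eq))
  shift′-≢-e0 x (no ∄n)       eq = ∄n (0 , sym eq)

¬finite⇒dedekindInfinite : ExcludedMiddle 0ℓ → ¬ IsFinite X → DedekindInfinite X
¬finite⇒dedekindInfinite lem X-infinite = ℕ↣⇒dedekindInfinite lem (ℕ↣ lem X-infinite)

ConstantOn : (Ω → Set) → (Ω → X) → Set
ConstantOn s c = ∀ {w w'} → s w → s w' → c w ≡ c w'

DeterminesOn : (Ω → Set) → (Ω → X) → (Ω → Y) → Set
DeterminesOn s c c' = ∀ {w w'} → s w → s w' → c w ≡ c w' → c' w ≡ c' w'

Avoids : (Ω → Set) → (Ω → X) → X → Set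
Avoids s c x = ∀ {w} → s w → c w ≢ x

SurjectiveOn : (Ω → Set) → (Ω → X) → Set
SurjectiveOn s c = ∀ x → ∃ λ w → s w × c w ≡ x

¬avoids⇒surjectiveOn : ExcludedMiddle 0ℓ → (s : Ω → Set) (c : Ω → X) →
  ¬ ∃ (Avoids s c) → SurjectiveOn s c
¬avoids⇒surjectiveOn lem s c ∄x x =
  decidable-stable lem λ ∄w → ∄x (x , λ sw cw≡x → ∄w (_ , sw , cw≡x))

surjective-determining-avoiding⇒dedekindInfinite : (s : Ω → Set) (c c' : Ω → X) {e : X} →
  SurjectiveOn s c → DeterminesOn s c' c → Avoids s c' e → DedekindInfinite X
surjective-determining-avoiding⇒dedekindInfinite {Ω = Ω} {X = X} s c c' c-onto c'→c c'-avoids-e =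
  mk↣ f-injective , _ , λ x → c'-avoids-e (s-pick x)
  where
  pick : X → Ω
  pick x = proj₁ (c-onto x)
  s-pick : ∀ x → s (pick x)
  s-pick x = proj₁ (proj₂ (c-onto x))
  c-pick : ∀ x → c (pick x) ≡ x
  c-pick x = proj₂ (proj₂ (c-onto x))
  f-injective : Injective _≡_ _≡_ (c' ∘ pick)
  f-injective {x} {y} eq =
    trans (sym (c-pick x)) (trans (c'→c (s-pick x) (s-pick y) eq) (c-pick y))

module Semantics (M : Model) where

  open Equivalence using (to; from)

  private variable
    s : State M
    g : Assignment M
    t t' : Term
    c c' : W M → D M
    x : ℕ
    d : D M

  -- The closed terms are exactly ca and cb; an inductive family (unlike a function of t)
  -- lets Agda infer t and the concept c from a proof of t denotes c.
  data _denotes_ : Term → (W M → D M) → Set where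
    ca-denotes : ca denotes aI M
    cb-denotes : cb denotes bI M

  denotation : t denotes c → ∀ g w → ⟦ M ⟧ t g w ≡ c w
  denotation ca-denotes _ _ = refl
  denotation cb-denotes _ _ = refl

  update-same : ∀ (g : Assignment M) x d → update M g x d x ≡ d
  update-same g x d with x ≟ x
  ... | yes _   = refl
  ... | no  x≢x = contradiction refl x≢x

  supports-≠⇔ : Supports M s g (t ≠' t') ⇔ (∀ {w} → s w → ⟦ M ⟧ t g w ≢ ⟦ M ⟧ t' g w)
  supports-≠⇔ = mk⇔
    (λ sup {w} sw eq → lower (sup (_≡ w) (λ { _ refl → sw }) (lift λ { _ refl → eq })) w refl)
    (λ ≢-on-s u u⊆s (lift ≡-on-u) → lift λ w uw → ≢-on-s (u⊆s w uw) (≡-on-u w uw))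

  supports-var≐⇔ : t denotes c → Supports M s (update M g x d) (var x ≐ t) ⇔ (∀ {w} → s w → c w ≡ d)
  supports-var≐⇔ {g = g} {x = x} {d = d} t↦c = mk⇔
    (λ (lift ≡-on-s) {w} sw →
       trans (sym (denotation t↦c _ w)) (trans (sym (≡-on-s w sw)) (update-same g x d)))
    (λ c≡d → lift λ w sw →
       trans (update-same g x d) (trans (sym (c≡d sw)) (sym (denotation t↦c _ w))))

  supports-var≠⇔avoids : t denotes c → Supports M s (update M g x d) (var x ≠' t) ⇔ Avoids s c d
  supports-var≠⇔avoids {t = t} {g = g} {x = x} {d = d} t↦c = mk⇔
    (λ sup {w} sw cw≡d → to (supports-≠⇔ {t = var x} {t' = t}) sup sw
       (trans (update-same g x d) (trans (sym cw≡d) (sym (denotation t↦c _ w)))))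
    (λ c-avoids-d → from (supports-≠⇔ {t = var x} {t' = t}) λ {w} sw eq →
       c-avoids-d sw (trans (sym (denotation t↦c _ w)) (trans (sym eq) (update-same g x d))))

  supports-λ⇔constantOn : ExcludedMiddle 0ℓ → t denotes c → Supports M s g (λ' t) ⇔ ConstantOn s c
  supports-λ⇔constantOn {t = t} {c = c} {s = s} {g = g} lem t↦c = mk⇔ constant λ-intro
    where
    constant : Supports M s g (λ' t) → ConstantOn s c
    constant sup {w} sw sw' with sup (c w)
    ... | inj₁ c≡cw  = sym (to (supports-var≐⇔ t↦c) c≡cw sw')
    ... | inj₂ c≢cw = contradiction refl (to (supports-var≠⇔avoids t↦c) c≢cw sw)
    λ-intro : ConstantOn s c → Supports M s g (λ' t)
    λ-intro c-const d with lem {∃ λ w → s w × c w ≡ d}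
    ... | yes (w₀ , sw₀ , cw₀≡d) =
      inj₁ (from (supports-var≐⇔ t↦c) λ sw → trans (c-const sw sw₀) cw₀≡d)
    ... | no  ∄w = inj₂ (from (supports-var≠⇔avoids t↦c) λ sw cw≡d → ∄w (_ , sw , cw≡d))

  supports-dep⇔determinesOn : ExcludedMiddle 0ℓ → t denotes c → t' denotes c' →
    Supports M s g (dep t t') ⇔ DeterminesOn s c c'
  supports-dep⇔determinesOn {t = t} {c = c} {t' = t'} {c' = c'} {s = s} {g = g} lem t↦c t'↦c' =
    mk⇔ determines dep-intro
    where
    λ⇔ : ∀ {u} → Supports M u g (λ' t) ⇔ ConstantOn u c
    λ⇔ = supports-λ⇔constantOn lem t↦c
    λ'⇔ : ∀ {u} → Supports M u g (λ' t') ⇔ ConstantOn u c'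
    λ'⇔ = supports-λ⇔constantOn lem t'↦c'

    determines : Supports M s g (dep t t') → DeterminesOn s c c'
    determines sup {w} {w'} sw sw' cw≡cw' =
      to λ'⇔ (sup pair pair⊆s (from λ⇔ c-constant)) (inj₁ refl) (inj₂ refl)
      where
      pair : State M
      pair v = v ≡ w ⊎ v ≡ w'
      pair⊆s : _⊆_ {M} pair s
      pair⊆s _ (inj₁ refl) = sw
      pair⊆s _ (inj₂ refl) = sw'
      c≡cw : ∀ {v} → pair v → c v ≡ c w
      c≡cw (inj₁ refl) = refl
      c≡cw (inj₂ refl) = sym cw≡cw'
      c-constant : ConstantOn pair c
      c-constant pv pv' = trans (c≡cw pv) (sym (c≡cw pv'))

    dep-intro : DeterminesOn s c c' → Supports M s g (dep t t')
    dep-intro c→c' u u⊆s λt = from λ'⇔ λ uw uw' →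
      c→c' (u⊆s _ uw) (u⊆s _ uw') (to λ⇔ λt uw uw')

  DedekindCondition : State M → Set₁
  DedekindCondition s = (u : State M) → _⊆_ {M} u s →
    DeterminesOn u (aI M) (bI M) → DeterminesOn u (bI M) (aI M) →
    ∃ (Avoids u (bI M)) → ∃ (Avoids u (aI M))

  supports-φab⇔dedekindCondition : ExcludedMiddle 0ℓ → Supports M s g φab ⇔ DedekindCondition s
  supports-φab⇔dedekindCondition {g = g} lem = mk⇔
    (λ sup u u⊆s a→b b→a (e , b-avoids-e) →
       let d , sup-u = sup u u⊆s (from a→b⇔ a→b , from b→a⇔ b→a , e , from ≠b⇔ b-avoids-e)
       in d , to ≠a⇔ sup-u)
    (λ condition u u⊆s (sup-ab , sup-ba , e , sup-≠b) →
       let d , a-avoids-d = condition u u⊆s (to a→b⇔ sup-ab) (to b→a⇔ sup-ba) (e , to ≠b⇔ sup-≠b)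
       in d , from ≠a⇔ a-avoids-d)
    where
    a→b⇔ : ∀ {u} → Supports M u g (dep ca cb) ⇔ DeterminesOn u (aI M) (bI M)
    a→b⇔ {u} = supports-dep⇔determinesOn {s = u} {g = g} lem ca-denotes cb-denotes
    b→a⇔ : ∀ {u} → Supports M u g (dep cb ca) ⇔ DeterminesOn u (bI M) (aI M)
    b→a⇔ {u} = supports-dep⇔determinesOn {s = u} {g = g} lem cb-denotes ca-denotes
    ≠a⇔ : ∀ {u d} → Supports M u (update M g 2 d) (var 2 ≠' ca) ⇔ Avoids u (aI M) d
    ≠a⇔ {u} {d} = supports-var≠⇔avoids {s = u} {g = g} {x = 2} {d = d} ca-denotes
    ≠b⇔ : ∀ {u d} → Supports M u (update M g 1 d) (var 1 ≠' cb) ⇔ Avoids u (bI M) d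
    ≠b⇔ {u} {d} = supports-var≠⇔avoids {s = u} {g = g} {x = 1} {d = d} cb-denotes

  finite⇒dedekindCondition : ExcludedMiddle 0ℓ → IsFinite (D M) → DedekindCondition s
  finite⇒dedekindCondition lem D-finite u _ a→b b→a (e , b-avoids-e) =
    decidable-stable lem λ ∄d → finite⇒¬dedekindInfinite D-finite
      (surjective-determining-avoiding⇒dedekindInfinite u (aI M) (bI M)
        (¬avoids⇒surjectiveOn lem u (aI M) ∄d) b→a b-avoids-e)

  graph : (D M → D M) → State M
  graph f w = bI M w ≡ f (aI M w)

  full⇒surjectiveOn-graph : IsFull M → (f : D M → D M) → SurjectiveOn (graph f) (aI M)
  full⇒surjectiveOn-graph full f d =
    let w , aw≡d , bw≡fd = full d (f d) in w , trans bw≡fd (cong f (sym aw≡d)) , aw≡d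

  dedekindInfinite⇒¬dedekindCondition : IsFull M → DedekindInfinite (D M) →
    ¬ DedekindCondition (Full-state M)
  dedekindInfinite⇒¬dedekindCondition full (f , e , e∉f) condition =
    let d , a-avoids-d = condition (graph f′) (λ _ _ → lift tt) a→b b→a (e , b-avoids-e)
        _ , graph-w , aw≡d = full⇒surjectiveOn-graph full f′ d
    in a-avoids-d graph-w aw≡d
    where
    open Injection f using (injective) renaming (to to f′)
    a→b : DeterminesOn (graph f′) (aI M) (bI M)
    a→b gw gw' aw≡aw' = trans gw (trans (cong f′ aw≡aw') (sym gw'))
    b→a : DeterminesOn (graph f′) (bI M) (aI M)
    b→a gw gw' bw≡bw' = injective (trans (sym gw) (trans bw≡bw' gw'))
    b-avoids-e : Avoids (graph f′) (bI M) e
    b-avoids-e {w} gw bw≡e = e∉f (aI M w) (trans (sym gw) bw≡e)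

proposition5 : ExcludedMiddle 0ℓ → ExcludedMiddle (lsuc 0ℓ) →
    (M : Model) → IsFull M → (M ⊨ φab) ⇔ IsFinite (D M)
-- Only small propositions are ever decided.
proposition5 lem _ M full = mk⇔
  (λ ⊨φab → decidable-stable lem λ D-infinite →
     dedekindInfinite⇒¬dedekindCondition full (¬finite⇒dedekindInfinite lem D-infinite)
       (to (supports-φab⇔dedekindCondition {g = g₀} lem) (⊨φab g₀)))
  (λ D-finite g →
     from (supports-φab⇔dedekindCondition {g = g} lem) (finite⇒dedekindCondition lem D-finite))
  where
  open Semantics M
  open Equivalence using (to; from)
  g₀ : Assignment M
  g₀ _ = d₀ M
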